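{- Let $G=(V,E)$ be a graph and $C$ a clique of $G$. Then the local neighborhood $\mathcal{N}_G(C)$ is the disjoint union \[\mathcal{N}_G(C)=\dot{\bigcup_{A\in\mathcal{A}_G(C)}}\mathcal{N}_G(A,C).\]
   Context: All graphs are finite, simple and undirected; $N_G(v)$ is the set of neighbors of $v$. For $W\subseteq V$ let $N_G^{\cap}(W)=\bigcap_{w\in W}N_G(w)$ (with $N_G^{\cap}(\emptyset)=V$) and $N_G^{\cup}(W)=\bigcup_{w\in W}N_G(w)$. For a clique $C$, the periphery is $P_G(C)=N_G^{\cup}(C)\setminus C$; for $M\subseteq P_G(C)$ the corresponding anchor set is $A_G(M,C)=N_G^{\cap}(M)\cap C$ when non-empty; $\mathcal{A}_G(C)=\{A\subseteq C\mid A\neq\emptyset,\ \exists M\subseteq P_G(C): A=A_G(M,C)\}$; and $\mathcal{P}_G(A,C)=\{M\subseteq P_G(C)\mid A_G(M,C)=A\}$. For $U\subseteq V$, the local neighborhood is $\mathcal{N}_G(U)=\{W\subseteq V\mid \exists v\in U: W\subseteq N_G(v)\}$. For $A\in\mathcal{A}_G(C)$, $\mathcal{N}_G(A,C)=\{N\in\mathcal{N}_G(C)\mid N\cap P_G(C)\in\mathcal{P}_G(A,C)\}$. -}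

module Defs where

open import Data.Nat using (ℕ; zero; suc)
open import Data.Bool using (Bool; true; false; _∧_; _∨_; not)
open import Data.Fin using (Fin; zero; suc)
open import Data.Fin.Subset using (Subset; _∈_; _⊆_; _∩_; ∁; Nonempty)
open import Data.Vec using (tabulate; lookup)
open import Data.Product using (Σ; ∃; _×_)
open import Relation.Binary.PropositionalEquality using (_≡_; _≢_)

record Graph (n : ℕ) : Set where
  field
    adj   : Fin n → Fin n → Bool
    sym   : ∀ u v → adj u v ≡ adj v u
    irrefl : ∀ v → adj v v ≡ false
open Graph public

∀ᵇ : ∀ {n} → (Fin n → Bool) → Bool
∀ᵇ {zero} f = true
∀ᵇ {suc n} f = f zero ∧ ∀ᵇ (λ i → f (suc i))

∃ᵇ : ∀ {n} → (Fin n → Bool) → Bool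
∃ᵇ {zero} f = false
∃ᵇ {suc n} f = f zero ∨ ∃ᵇ (λ i → f (suc i))

module _ {n : ℕ} (G : Graph n) where

  Nbr : Fin n → Subset n
  Nbr v = tabulate (adj G v)

  -- N_G^∩(W) (equals V for W = ∅)
  Ncap : Subset n → Subset n
  Ncap W = tabulate λ u → ∀ᵇ (λ w → not (lookup W w) ∨ adj G w u)

  Ncup : Subset n → Subset n
  Ncup W = tabulate λ u → ∃ᵇ (λ w → lookup W w ∧ adj G w u)

  IsClique : Subset n → Set
  IsClique C = ∀ u v → u ∈ C → v ∈ C → u ≢ v → adj G u v ≡ true

  Periphery : Subset n → Subset n
  Periphery C = Ncup C ∩ ∁ C

  -- A_G(M,C) (only used as an anchor set when non-empty)
  Anchor : Subset n → Subset n → Subset n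
  Anchor M C = Ncap M ∩ C

  InAnchors : Subset n → Subset n → Set
  InAnchors A C = Nonempty A × ∃ λ M → M ⊆ Periphery C × A ≡ Anchor M C

  InPeriph : Subset n → Subset n → Subset n → Set
  InPeriph M A C = M ⊆ Periphery C × Anchor M C ≡ A

  InLocNbhd : Subset n → Subset n → Set
  InLocNbhd W U = ∃ λ v → v ∈ U × W ⊆ Nbr v

  InLocNbhdA : Subset n → Subset n → Subset n → Set
  InLocNbhdA N A C = InLocNbhd N C × InPeriph (N ∩ Periphery C) A C

module Submission where

-- A local neighbourhood N ⊆ N_G(v) with v ∈ C determines its anchor set uniquely, namely
-- A_G(N ∩ P_G(C), C); this set is non-empty because it contains v, which is adjacent to
-- every vertex of N.

open import Defs
open import Data.Nat using (ℕ; zero; suc)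
open import Data.Fin using (Fin; zero; suc)
open import Data.Fin.Subset using (Subset; _∩_; _∈_; _⊆_)
open import Data.Fin.Subset.Properties using (x∈p∩q⁺; p∩q⊆p; p∩q⊆q)
open import Data.Vec using (lookup; tabulate)
open import Data.Vec.Properties using ([]=⇒lookup; lookup⇒[]=; lookup∘tabulate)
open import Data.Bool using (Bool; true; false; not; _∨_)
open import Data.Product using (∃; _×_; _,_)
open import Relation.Binary.PropositionalEquality using (_≡_; _≢_; refl; trans) renaming (sym to ≡-sym)
open import Relation.Nullary using (¬_)
open import Function.Bundles using (_⇔_; mk⇔)

∀ᵇ-intro : ∀ {n} (f : Fin n → Bool) → (∀ i → f i ≡ true) → ∀ᵇ f ≡ true
∀ᵇ-intro {zero}  f h = refl
∀ᵇ-intro {suc n} f h rewrite h zero = ∀ᵇ-intro (λ i → f (suc i)) (λ i → h (suc i))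

∈-tabulate⁺ : ∀ {n} (f : Fin n → Bool) {i} → f i ≡ true → i ∈ tabulate f
∈-tabulate⁺ f {i} fi = lookup⇒[]= i _ (trans (lookup∘tabulate f i) fi)

∈-tabulate⁻ : ∀ {n} (f : Fin n → Bool) {i} → i ∈ tabulate f → f i ≡ true
∈-tabulate⁻ f {i} i∈ = trans (≡-sym (lookup∘tabulate f i)) ([]=⇒lookup i∈)

module _ {n : ℕ} (G : Graph n) where

  ∈Ncap⁺ : ∀ {W v} → (∀ {w} → w ∈ W → adj G w v ≡ true) → v ∈ Ncap G W
  ∈Ncap⁺ {W} {v} adjacent = ∈-tabulate⁺ _ (∀ᵇ-intro _ outside-or-adjacent)
    where
    outside-or-adjacent : ∀ w → (not (lookup W w) ∨ adj G w v) ≡ true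
    outside-or-adjacent w with lookup W w in w∈W
    ... | false = refl
    ... | true  = adjacent (lookup⇒[]= w W w∈W)

  ⊆Nbr⇒∈Ncap : ∀ {W v} → W ⊆ Nbr G v → v ∈ Ncap G W
  ⊆Nbr⇒∈Ncap {v = v} W⊆Nv = ∈Ncap⁺ λ {w} w∈W →
    trans (Graph.sym G w v) (∈-tabulate⁻ (adj G v) (W⊆Nv w∈W))

  module _ (C : Subset n) where

    peripheral : Subset n → Subset n
    peripheral N = N ∩ Periphery G C

    peripheral⊆Periphery : ∀ N → peripheral N ⊆ Periphery G C
    peripheral⊆Periphery N = p∩q⊆q N (Periphery G C)

    anchor-of-local-nbhd : ∀ {N} → InLocNbhd G N C → InAnchors G (Anchor G (peripheral N) C) C
    anchor-of-local-nbhd {N} (v , v∈C , N⊆Nv) =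
      (v , x∈p∩q⁺ (⊆Nbr⇒∈Ncap (λ x∈ → N⊆Nv (p∩q⊆p N _ x∈)) , v∈C)) ,
      peripheral N , peripheral⊆Periphery N , refl

    local-nbhd-anchored : ∀ {N} → InLocNbhd G N C →
                          InLocNbhdA G N (Anchor G (peripheral N) C) C
    local-nbhd-anchored {N} loc = loc , peripheral⊆Periphery N , refl

    anchor-unique : ∀ {N A A′} → InLocNbhdA G N A C → InLocNbhdA G N A′ C → A ≡ A′
    anchor-unique (_ , _ , anchor≡A) (_ , _ , anchor≡A′) = trans (≡-sym anchor≡A) anchor≡A′

lemma8 : ∀ {n : ℕ} (G : Graph n) (C : Subset n) → IsClique G C →
           (∀ (N : Subset n) → InLocNbhd G N C ⇔ (∃ λ A → InAnchors G A C × InLocNbhdA G N A C))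
           × (∀ (A A′ : Subset n) → InAnchors G A C → InAnchors G A′ C → A ≢ A′ →
                ∀ (N : Subset n) → InLocNbhdA G N A C → ¬ InLocNbhdA G N A′ C)
lemma8 G C _ = covering , disjoint
  where
  covering : ∀ N → InLocNbhd G N C ⇔ (∃ λ A → InAnchors G A C × InLocNbhdA G N A C)
  covering N = mk⇔
    (λ loc → _ , anchor-of-local-nbhd G C loc , local-nbhd-anchored G C loc)
    (λ { (_ , _ , loc , _) → loc })

  disjoint : ∀ A A′ → InAnchors G A C → InAnchors G A′ C → A ≢ A′ →
             ∀ N → InLocNbhdA G N A C → ¬ InLocNbhdA G N A′ C
  disjoint _ _ _ _ A≢A′ _ inA inA′ = A≢A′ (anchor-unique G C inA inA′)
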